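{- Let $G=(\Sigma,I,L,\rightarrow)$ be a transition system with $\Sigma$ finite. Let $R_i$ be a preorder on $\Sigma$, and let $\sigma_i\subseteq\mathrm{post}^*(I)$ be finite. Let $\langle P,\tau,Q,\sigma\rangle$ be the output of Algorithm 2 (described in the context) on input $G,R_i,\sigma_i$. Let $R_{\mathrm{sim}}$ and $P_{\mathrm{sim}}$ be, respectively, the simulation preorder and simulation partition of $G$ w.r.t. $R_i$. Then: \[R_{\mathrm{sim}}^{\mathrm{post}^*(I)}=R_{\langle P,\tau,Q\rangle}^{\sigma},\] and \[P_{\mathrm{sim}}^{\mathrm{post}^*(I)}\subseteq\{B\in P_{\langle P,\tau,Q\rangle}\mid\exists E\in P.\ E\subseteq B\wedge(\textstyle\bigcup\tau(E))\cap\sigma\neq\varnothing\}.\]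
   Context: Transition system, operators and simulation. - $G=(\Sigma,I,L,\rightarrow)$ has states $\Sigma$, initial states $I$, finite label set $L$, and transitions $x\xrightarrow{a}y$. - $\mathrm{pre}_a(Y)=\{x\mid\exists y\in Y.\ x\xrightarrow{a}y\}$. - $\mathrm{post}(X)=\{y\mid\exists x\in X,a.\ x\xrightarrow{a}y\}$ and $\mathrm{post}^*(X)=\bigcup_n\mathrm{post}^n(X)$. - A relation $R\subseteq\Sigma\times\Sigma$ is a simulation w.r.t. a preorder $R_i$ if $R\subseteq R_i$ and, whenever $(s,t)\in R$ and $s\xrightarrow{a}s'$, there is $t'$ with $t\xrightarrow{a}t'$ and $(s',t')\in R$. - $R_{\mathrm{sim}}$ is the greatest simulation, and $P_{\mathrm{sim}}$ is the partition induced by $R_{\mathrm{sim}}\cap R_{\mathrm{sim}}^{ -1}$. Notation for relations and partitions. - For a relation $R$: $R(x)=\{y\mid(x,y)\in R\}$, $R(S)=\bigcup_{x\in S}R(x)$, and $R^S=\{R(x)\mid x\in\Sigma,\ R(x)\cap S\neq\varnothing\}$. - For a partition $P$: $P^S=\{B\in P\mid B\cap S\neq\varnothing\}$. 2PR triples. - A 2PR triple is $\langle P,\tau,Q\rangle$, where $P,Q$ are partitions of $\Sigma$ and $\tau:P\to\wp(Q)$. - It encodes the relation $R_{\langle P,\tau,Q\rangle}(x)=\bigcup\tau(P(x))$, where $P(x)$ is the block of $P$ containing $x$. - It also encodes the partition $P_{\langle P,\tau,Q\rangle}=\{\{y\mid\bigcup\tau(P(y))=\bigcup\tau(P(x))\}\mid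 x\in\Sigma\}$. Algorithm 2. Initialization: - $P:=\{\{y\mid R_i(y)=R_i(x)\}\mid x\in\Sigma\}$; - $Q:=\{\{y\mid R_i^{ -1}(y)=R_i^{ -1}(x)\}\mid x\in\Sigma\}$; - $\tau(B):=\{C\in Q\mid C\subseteq R_i(B)\}$ for each $B\in P$; - $\sigma:=\sigma_i$. The algorithm then repeats the following forever. - Compute \[U=\{B\in P\mid\textstyle\bigcup\tau(B)\cap\sigma=\varnothing,\ \bigcup\tau(B)\cap(I\cup\mathrm{post}(\sigma))\neq\varnothing\}\] and \[V=\{\langle a,B,C\rangle\in L\times P^2\mid\textstyle\bigcup\tau(B)\cap\sigma\neq\varnothing,\ B\cap\mathrm{pre}_a(C)\neq\varnothing,\ \bigcup\tau(B)\not\subseteq\mathrm{pre}_a(\bigcup\tau(C))\}.\] - Then nondeterministically execute one enabled guarded command: - (Search) if $U\neq\varnothing$: choose $B\in U$ and $s\in\bigcup\tau(B)\cap(I\cup\mathrm{post}(\sigma))$, and set $\sigma:=\sigma\cup\{s\}$. - (Refine) if $V\neq\varnothing$: choose $\langle a,B,C\rangle\in V$ and perform these steps in order. 1. Let $S:=\mathrm{pre}_a(\bigcup\tau(C))$, $B':=B\cap\mathrm{pre}_a(C)$ and $B'':=B\setminus\mathrm{pre}_a(C)$. 2. In $P$, replace $B$ by $B'$ and $B''$, and set $\tau(B'):=\tau(B)$ and $\tau(B''):=\tau(B)$. 3. For each $X\in\tau(B')$ with $X\cap S\neq\varnothing$ and $X\not\subseteq S$: in $Q$ replace $X$ by $X\cap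 S$ and $X\setminus S$, and in every $\tau(A)$, $A\in P$, replace $X$ by $X\cap S$ and $X\setminus S$. 4. Set $\tau(B'):=\{E\in\tau(B')\mid E\subseteq S\}$. - if $U=V=\varnothing$: return $\langle P,\tau,Q,\sigma\rangle$. -}

module Defs where

open import Data.Bool using (Bool; true; false; T; _∧_; _∨_; not; if_then_else_)
open import Data.Nat using (ℕ)
open import Data.Fin using (Fin)
open import Data.Fin.Subset using (Subset; _∈_; _⊆_; _∩_; _∪_; ∁; ⋃; ⁅_⁆; Nonempty; Empty)
open import Data.Fin.Subset.Properties using (nonempty?; _⊆?_)
open import Data.List using (List; []; _∷_; concatMap; filterᵇ; deduplicate; map; allFin)
open import Data.Bool.ListAction using (any)
open import Data.List.Membership.Propositional renaming (_∈_ to _∈ₗ_)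
open import Data.Vec using (tabulate; lookup)
open import Data.Vec.Properties using (≡-dec)
import Data.Bool.Properties as BoolP
open import Data.Product using (Σ; ∃; _×_; _,_)
open import Relation.Nullary using (¬_; ⌊_⌋)
open import Relation.Binary.PropositionalEquality using (_≡_)
open import Relation.Binary.Construct.Closure.ReflexiveTransitive using (Star)
open import Function using (_⇔_)

_≟ˢ_ : ∀ {n} (A B : Subset n) → Relation.Nullary.Dec (A ≡ B)
_≟ˢ_ = ≡-dec BoolP._≟_

-- A finite transition system G = (Σ, I, L, →) with Σ = Fin n, L = Fin m.
-- The transition relation is given by its (Bool-valued) characteristic
-- function:  tr a x y = true  iff  x -a-> y.

module TS {n m : ℕ} (I : Subset n) (tr : Fin m → Fin n → Fin n → Bool) where

  anyΣ : (Fin n → Bool) → Bool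
  anyΣ f = any f (allFin n)

  anyL : (Fin m → Bool) → Bool
  anyL f = any f (allFin m)

  _∈ᵇ_ : Fin n → Subset n → Bool
  x ∈ᵇ X = lookup X x

  pre : Fin m → Subset n → Subset n
  pre a Y = tabulate (λ x → anyΣ (λ y → tr a x y ∧ (y ∈ᵇ Y)))

  post : Subset n → Subset n
  post X = tabulate (λ y → anyΣ (λ x → (x ∈ᵇ X) ∧ anyL (λ a → tr a x y)))

  data Reach : Fin n → Set where
    init : ∀ {x} → x ∈ I → Reach x
    step : ∀ {x y} (a : Fin m) → Reach x → T (tr a x y) → Reach y

  IsSimulation : (Ri : Fin n → Fin n → Bool) → (Fin n → Fin n → Set) → Set
  IsSimulation Ri R =
    (∀ s t → R s t → T (Ri s t)) ×
    (∀ s t a s' → R s t → T (tr a s s') → ∃ λ t' → T (tr a t t') × R s' t')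

  IsGreatestSimulation : (Ri : Fin n → Fin n → Bool) → (Fin n → Fin n → Set) → Set₁
  IsGreatestSimulation Ri R =
    IsSimulation Ri R × (∀ R' → IsSimulation Ri R' → ∀ s t → R' s t → R s t)

  IsPreorderᵇ : (Fin n → Fin n → Bool) → Set
  IsPreorderᵇ Ri = (∀ x → T (Ri x x)) × (∀ x y z → T (Ri x y) → T (Ri y z) → T (Ri x z))

  -- 2PR triples with the set σ: states of Algorithm 2.
  -- P and Q are lists of blocks (subsets of Σ); τ(B) is a list of Q-blocks
  -- (τ is a total function on subsets; only its values on P-blocks matter).

  record AState : Set where
    constructor ⟨_,_,_,_⟩
    field
      P : List (Subset n)
      τ : Subset n → List (Subset n)
      Q : List (Subset n)
      σ : Subset n
  open AState public

  Uτ : AState → Subset n → Subset n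
  Uτ st B = ⋃ (τ st B)

  module Init (Ri : Fin n → Fin n → Bool) (σi : Subset n) where

    row : Fin n → Subset n
    row x = tabulate (Ri x)

    col : Fin n → Subset n
    col x = tabulate (λ y → Ri y x)

    P₀ : List (Subset n)
    P₀ = deduplicate _≟ˢ_ (map (λ x → tabulate (λ y → ⌊ row y ≟ˢ row x ⌋)) (allFin n))

    Q₀ : List (Subset n)
    Q₀ = deduplicate _≟ˢ_ (map (λ x → tabulate (λ y → ⌊ col y ≟ˢ col x ⌋)) (allFin n))

    rowB : Subset n → Subset n
    rowB B = tabulate (λ y → anyΣ (λ x → (x ∈ᵇ B) ∧ Ri x y))

    τ₀ : Subset n → List (Subset n)
    τ₀ B = filterᵇ (λ C → ⌊ C ⊆? rowB B ⌋) Q₀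

    initial : AState
    initial = ⟨ P₀ , τ₀ , Q₀ , σi ⟩

  InU : AState → Subset n → Set
  InU st B = B ∈ₗ P st × Empty (Uτ st B ∩ σ st) × Nonempty (Uτ st B ∩ (I ∪ post (σ st)))

  InV : AState → Fin m → Subset n → Subset n → Set
  InV st a B C =
    B ∈ₗ P st × C ∈ₗ P st × Nonempty (Uτ st B ∩ σ st) ×
    Nonempty (B ∩ pre a C) × ¬ (Uτ st B ⊆ pre a (Uτ st C))

  Terminal : AState → Set
  Terminal st = (∀ B → ¬ InU st B) × (∀ a B C → ¬ InV st a B C)

  search : AState → Fin n → AState
  search ⟨ P , τ , Q , σ ⟩ s = ⟨ P , τ , Q , σ ∪ ⁅ s ⁆ ⟩

  refine : AState → Fin m → Subset n → Subset n → AState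
  refine st a B C = ⟨ P₁ , τ₃ , Q₂ , σ st ⟩
    where
    S   = pre a (Uτ st C)
    B'  = B ∩ pre a C
    B'' = B ∩ ∁ (pre a C)
    -- step 2: replace B by B' and B'' (B'' only if nonempty, blocks of a
    -- partition being nonempty); τ(B') := τ(B), τ(B'') := τ(B)
    P₁ : List (Subset n)
    P₁ = concatMap (λ A → if ⌊ A ≟ˢ B ⌋
                           then B' ∷ (if ⌊ nonempty? B'' ⌋ then B'' ∷ [] else [])
                           else A ∷ []) (P st)
    τ₁ : Subset n → List (Subset n)
    τ₁ A = if ⌊ A ≟ˢ B' ⌋ ∨ ⌊ A ≟ˢ B'' ⌋ then τ st B else τ st A
    splitX : Subset n → List (Subset n)
    splitX X = if any (λ Z → ⌊ Z ≟ˢ X ⌋) (τ₁ B') ∧ ⌊ nonempty? (X ∩ S) ⌋ ∧ not ⌊ X ⊆? S ⌋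
               then (X ∩ S) ∷ (X ∩ ∁ S) ∷ []
               else X ∷ []
    Q₂ : List (Subset n)
    Q₂ = concatMap splitX (Q st)
    τ₂ : Subset n → List (Subset n)
    τ₂ A = concatMap splitX (τ₁ A)
    τ₃ : Subset n → List (Subset n)
    τ₃ A = if ⌊ A ≟ˢ B' ⌋ then filterᵇ (λ E → ⌊ E ⊆? S ⌋) (τ₂ A) else τ₂ A

  data Step : AState → AState → Set where
    searchStep : ∀ {st} B s → InU st B → s ∈ Uτ st B ∩ (I ∪ post (σ st)) →
                 Step st (search st s)
    refineStep : ∀ {st} a B C → InV st a B C → Step st (refine st a B C)

  IsOutput : (Ri : Fin n → Fin n → Bool) (σi : Subset n) → AState → Set
  IsOutput Ri σi st = Star Step (Init.initial Ri σi) st × Terminal st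

  -- Relation and partition encoded by a 2PR triple, and R^S, P^S
  -- y ∈ R_{⟨P,τ,Q⟩}(x)  iff  y ∈ ⋃ τ(P(x)), P(x) the block of P containing x
  R2PR : AState → Fin n → Fin n → Set
  R2PR st x y = ∃ λ B → B ∈ₗ P st × x ∈ B × y ∈ Uτ st B

  _≐_ : (Fin n → Set) → (Fin n → Set) → Set
  X ≐ Y = ∀ z → X z ⇔ Y z

  -- block of P_{⟨P,τ,Q⟩} containing x
  block2PR : AState → Fin n → Fin n → Set
  block2PR st x y = R2PR st y ≐ R2PR st x

  blockSim : (Fin n → Fin n → Set) → Fin n → Fin n → Set
  blockSim R x y = R x y × R y x

  -- R_sim^{post*(I)} = R_{⟨P,τ,Q⟩}^σ   (equality of sets of images)
  ImagesEq : (Fin n → Fin n → Set) → AState → Set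
  ImagesEq Rsim st =
    (∀ x → (∃ λ z → Rsim x z × Reach z) →
       ∃ λ y → (∃ λ z → R2PR st y z × z ∈ σ st) × (Rsim x ≐ R2PR st y)) ×
    (∀ y → (∃ λ z → R2PR st y z × z ∈ σ st) →
       ∃ λ x → (∃ λ z → Rsim x z × Reach z) × (Rsim x ≐ R2PR st y))

  -- P_sim^{post*(I)} ⊆ {B ∈ P_{⟨P,τ,Q⟩} | ∃E∈P. E ⊆ B ∧ ⋃τ(E) ∩ σ ≠ ∅}
  BlocksIncl : (Fin n → Fin n → Set) → AState → Set
  BlocksIncl Rsim st =
    ∀ x → (∃ λ z → blockSim Rsim x z × Reach z) →
      ∃ λ x' → (blockSim Rsim x ≐ block2PR st x') ×
        ∃ λ E → E ∈ₗ P st × (∀ z → z ∈ E → block2PR st x' z) ×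
                Nonempty (Uτ st E ∩ σ st)

-- Every command of Algorithm 2 preserves an invariant: P partitions Σ,
-- R_sim ⊆ R_⟨P,τ,Q⟩ ⊆ R_i, and σ ⊆ post*(I).  Refine keeps R_sim below the
-- encoded relation because a state simulating some x ∈ B ∩ pre_a(C) has an
-- a-successor simulating a state of C, so it lies in pre_a(⋃τ(C)).
-- On termination call x active when ⋃τ(P(x)) meets σ.  As U = V = ∅, every
-- reachable state is active, hence so is every state it simulates; as V = ∅,
-- R_⟨P,τ,Q⟩ restricted to active states is a simulation, hence below R_sim.
-- Thus R_sim(x) = R_⟨P,τ,Q⟩(x) for active x, which yields both claims.
module Submission where

open import Defs
open import Data.Bool using (Bool; true; false; T; _∧_; _∨_; not; if_then_else_)
open import Data.Bool.ListAction using (any)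
open import Data.Bool.Properties using (T-≡; T-∧; T?)
open import Data.Nat using (ℕ)
open import Data.Fin using (Fin)
open import Data.Fin.Subset using (Subset; _∈_; _⊆_; _∩_; _∪_; ∁; ⋃; ⁅_⁆; Nonempty)
open import Data.Fin.Subset.Properties
  using (nonempty?; _⊆?_; _∈?_; ∉⊥; x∈p∪q⁻; x∈p∪q⁺; x∈p∩q⁺; p∩q⊆p; p∩q⊆q;
         x∈p⇒x∉∁p; x∉p⇒x∈∁p; x∈⁅y⁆⇒x≡y)
open import Data.List using (List; []; _∷_; concatMap; filterᵇ; allFin)
open import Data.List.Membership.Propositional using (find; lose) renaming (_∈_ to _∈ₗ_)
open import Data.List.Membership.Propositional.Properties
  using (∈-map⁺; ∈-map⁻; ∈-concatMap⁺; ∈-concatMap⁻; ∈-filter⁺; ∈-filter⁻;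
         ∈-deduplicate⁺; ∈-deduplicate⁻; ∈-allFin)
open import Data.List.Relation.Unary.Any using (here; there)
open import Data.List.Relation.Unary.Any.Properties using (any⁺; any⁻)
open import Data.Vec using (tabulate; lookup)
open import Data.Vec.Properties using ([]=⇒lookup; lookup⇒[]=; lookup∘tabulate)
open import Data.Product using (∃; _×_; _,_; proj₁; proj₂)
open import Data.Sum using (_⊎_; inj₁; inj₂; [_,_])
open import Data.Empty using (⊥; ⊥-elim)
open import Function using (_∘_; _⇔_; mk⇔; Equivalence)
open import Relation.Nullary using (¬_; ⌊_⌋; Dec; yes; no; contradiction)
open import Relation.Nullary.Decidable using (toWitness; fromWitness; fromWitnessFalse)
open import Relation.Binary.PropositionalEquality using (_≡_; _≢_; refl; sym; trans; cong; subst; _≗_)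
open import Relation.Binary.Construct.Closure.ReflexiveTransitive using (Star; ε; _◅_)

if-yes : ∀ {P A : Set} (d : Dec P) {x y : A} → P → (if ⌊ d ⌋ then x else y) ≡ x
if-yes (yes _) _ = refl
if-yes (no ¬p) p = contradiction p ¬p

if-no : ∀ {P A : Set} (d : Dec P) {x y : A} → ¬ P → (if ⌊ d ⌋ then x else y) ≡ y
if-no (yes p) ¬p = contradiction p ¬p
if-no (no _) _ = refl

module _ {n : ℕ} where

  T[lookup]⇒∈ : ∀ {p : Subset n} {x} → T (lookup p x) → x ∈ p
  T[lookup]⇒∈ {p} {x} t = lookup⇒[]= x p (Equivalence.to T-≡ t)

  ∈⇒T[lookup] : ∀ {p : Subset n} {x} → x ∈ p → T (lookup p x)
  ∈⇒T[lookup] x∈p = Equivalence.from T-≡ ([]=⇒lookup x∈p)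

  x∈tabulate⁻ : ∀ {f : Fin n → Bool} {x} → x ∈ tabulate f → T (f x)
  x∈tabulate⁻ {f} {x} x∈ = subst T (lookup∘tabulate f x) (∈⇒T[lookup] x∈)

  x∈tabulate⁺ : ∀ {f : Fin n → Bool} {x} → T (f x) → x ∈ tabulate f
  x∈tabulate⁺ {f} {x} t = T[lookup]⇒∈ (subst T (sym (lookup∘tabulate f x)) t)

  tabulate-injective : ∀ {A : Set} {f g : Fin n → A} → tabulate f ≡ tabulate g → f ≗ g
  tabulate-injective {f = f} {g} e x =
    trans (sym (lookup∘tabulate f x)) (trans (cong (λ v → lookup v x) e) (lookup∘tabulate g x))

  x∈⋃⁻ : ∀ (ps : List (Subset n)) {x} → x ∈ ⋃ ps → ∃ λ p → p ∈ₗ ps × x ∈ p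
  x∈⋃⁻ []       x∈ = contradiction x∈ ∉⊥
  x∈⋃⁻ (p ∷ ps) x∈ with x∈p∪q⁻ p (⋃ ps) x∈
  ... | inj₁ x∈p  = p , here refl , x∈p
  ... | inj₂ x∈ps = let q , q∈ps , x∈q = x∈⋃⁻ ps x∈ps in q , there q∈ps , x∈q

  x∈⋃⁺ : ∀ {ps : List (Subset n)} {p x} → p ∈ₗ ps → x ∈ p → x ∈ ⋃ ps
  x∈⋃⁺ (here refl) x∈p = x∈p∪q⁺ (inj₁ x∈p)
  x∈⋃⁺ (there p∈) x∈p = x∈p∪q⁺ (inj₂ (x∈⋃⁺ p∈ x∈p))

  ⋃-mono : ∀ {ps qs : List (Subset n)} → (∀ {p} → p ∈ₗ ps → p ∈ₗ qs) → ⋃ ps ⊆ ⋃ qs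
  ⋃-mono {ps} ps⊆qs x∈ with x∈⋃⁻ ps x∈
  ... | p , p∈ps , x∈p = x∈⋃⁺ (ps⊆qs p∈ps) x∈p

  splitIf : Bool → Subset n → Subset n → List (Subset n)
  splitIf b X S = if b then X ∩ S ∷ X ∩ ∁ S ∷ [] else X ∷ []

  splitIf-⊆ : ∀ b X S {Y} → Y ∈ₗ splitIf b X S → Y ⊆ X
  splitIf-⊆ true  X S (here refl)         = p∩q⊆p X S
  splitIf-⊆ true  X S (there (here refl)) = p∩q⊆p X (∁ S)
  splitIf-⊆ false X S (here refl)         = λ x∈ → x∈

  splitIf-covers : ∀ b X S {x} → x ∈ X → ∃ λ Y → Y ∈ₗ splitIf b X S × x ∈ Y
  splitIf-covers false X S x∈X = X , here refl , x∈X
  splitIf-covers true  X S {x} x∈X with x ∈? S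
  ... | yes x∈S = X ∩ S , here refl , x∈p∩q⁺ (x∈X , x∈S)
  ... | no  x∉S = X ∩ ∁ S , there (here refl) , x∈p∩q⁺ (x∈X , x∉p⇒x∈∁p x∉S)

  splitIf-covers-inside : ∀ b X S {x} → x ∈ X → x ∈ S → (¬ X ⊆ S → T b) →
                          ∃ λ Y → Y ∈ₗ splitIf b X S × x ∈ Y × Y ⊆ S
  splitIf-covers-inside true  X S x∈X x∈S _ = X ∩ S , here refl , x∈p∩q⁺ (x∈X , x∈S) , p∩q⊆q X S
  splitIf-covers-inside false X S x∈X x∈S ⊈⇒split with X ⊆? S
  ... | yes X⊆S = X , here refl , x∈X , X⊆S
  ... | no  X⊈S = ⊥-elim (⊈⇒split X⊈S)

  module _ (splits : Subset n → Bool) (S : Subset n) where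

    ⋃-splitIf⁻ : ∀ Xs → ⋃ (concatMap (λ X → splitIf (splits X) X S) Xs) ⊆ ⋃ Xs
    ⋃-splitIf⁻ Xs x∈ with x∈⋃⁻ (concatMap (λ X → splitIf (splits X) X S) Xs) x∈
    ... | Y , Y∈ , x∈Y with find (∈-concatMap⁻ (λ X → splitIf (splits X) X S) {Xs} Y∈)
    ... | X , X∈Xs , Y∈split = x∈⋃⁺ X∈Xs (splitIf-⊆ (splits X) X S Y∈split x∈Y)

    ⋃-splitIf⁺ : ∀ Xs → ⋃ Xs ⊆ ⋃ (concatMap (λ X → splitIf (splits X) X S) Xs)
    ⋃-splitIf⁺ Xs x∈ with x∈⋃⁻ Xs x∈
    ... | X , X∈Xs , x∈X with splitIf-covers (splits X) X S x∈X
    ... | Y , Y∈split , x∈Y =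
      x∈⋃⁺ (∈-concatMap⁺ (λ X → splitIf (splits X) X S) (lose X∈Xs Y∈split)) x∈Y

module Algorithm2 {n m : ℕ} (I : Subset n) (tr : Fin m → Fin n → Fin n → Bool) where

  open TS I tr

  x∈pre⁻ : ∀ {a x Y} → x ∈ pre a Y → ∃ λ y → T (tr a x y) × y ∈ Y
  x∈pre⁻ x∈ with find (any⁻ _ (allFin n) (x∈tabulate⁻ x∈))
  ... | y , _ , t = let t₁ , t₂ = Equivalence.to T-∧ t in y , t₁ , T[lookup]⇒∈ t₂

  x∈pre⁺ : ∀ {a x y Y} → T (tr a x y) → y ∈ Y → x ∈ pre a Y
  x∈pre⁺ {y = y} t y∈Y =
    x∈tabulate⁺ (any⁺ _ (lose (∈-allFin y) (Equivalence.from T-∧ (t , ∈⇒T[lookup] y∈Y))))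

  y∈post⁻ : ∀ {X y} → y ∈ post X → ∃ λ x → x ∈ X × ∃ λ a → T (tr a x y)
  y∈post⁻ y∈ with find (any⁻ _ (allFin n) (x∈tabulate⁻ y∈))
  ... | x , _ , t with Equivalence.to T-∧ t
  ... | x∈X , t′ with find (any⁻ _ (allFin m) t′)
  ... | a , _ , x→y = x , T[lookup]⇒∈ x∈X , a , x→y

  y∈post⁺ : ∀ {X x y a} → x ∈ X → T (tr a x y) → y ∈ post X
  y∈post⁺ {x = x} {a = a} x∈X x→y =
    x∈tabulate⁺ (any⁺ _ (lose (∈-allFin x)
      (Equivalence.from T-∧ (∈⇒T[lookup] x∈X , any⁺ _ (lose (∈-allFin a) x→y)))))

  module Correctness (Ri : Fin n → Fin n → Bool) (preorder : IsPreorderᵇ Ri)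
                     (Rsim : Fin n → Fin n → Set) (greatest : IsGreatestSimulation Ri Rsim) where

    Rsim⊆Ri : ∀ {x y} → Rsim x y → T (Ri x y)
    Rsim⊆Ri = proj₁ (proj₁ greatest) _ _

    Rsim-step : ∀ {x y a x'} → Rsim x y → T (tr a x x') → ∃ λ y' → T (tr a y y') × Rsim x' y'
    Rsim-step r t = proj₂ (proj₁ greatest) _ _ _ _ r t

    Rsim-refl : ∀ x → Rsim x x
    Rsim-refl x = proj₂ greatest _≡_ (≡⊆Ri , ≡-step) x x refl
      where
      ≡⊆Ri : ∀ s t → s ≡ t → T (Ri s t)
      ≡⊆Ri s .s refl = proj₁ preorder s
      ≡-step : ∀ s t a s' → s ≡ t → T (tr a s s') → ∃ λ t' → T (tr a t t') × s' ≡ t'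
      ≡-step s .s a s' refl t = s' , t , refl

    Rsim-trans : ∀ {x y z} → Rsim x y → Rsim y z → Rsim x z
    Rsim-trans {x} {y} {z} r r′ = proj₂ greatest Rsim² (Rsim²⊆Ri , Rsim²-step) x z (y , r , r′)
      where
      Rsim² : Fin n → Fin n → Set
      Rsim² s u = ∃ λ t → Rsim s t × Rsim t u
      Rsim²⊆Ri : ∀ s u → Rsim² s u → T (Ri s u)
      Rsim²⊆Ri s u (t , r₁ , r₂) = proj₂ preorder s t u (Rsim⊆Ri r₁) (Rsim⊆Ri r₂)
      Rsim²-step : ∀ s u a s' → Rsim² s u → T (tr a s s') → ∃ λ u' → T (tr a u u') × Rsim² s' u'
      Rsim²-step s u a s' (t , r₁ , r₂) s→s' with Rsim-step r₁ s→s'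
      ... | t' , t→t' , r₁' with Rsim-step r₂ t→t'
      ... | u' , u→u' , r₂' = u' , u→u' , t' , r₁' , r₂'

    record Invariant (st : AState) : Set where
      field
        covers      : ∀ x → ∃ λ A → A ∈ₗ P st × x ∈ A
        disjoint    : ∀ {x A A'} → A ∈ₗ P st → A' ∈ₗ P st → x ∈ A → x ∈ A' → A ≡ A'
        Rsim⊆R      : ∀ {A x y} → A ∈ₗ P st → x ∈ A → Rsim x y → y ∈ Uτ st A
        R⊆Ri        : ∀ {A x y} → A ∈ₗ P st → x ∈ A → y ∈ Uτ st A → T (Ri x y)
        σ-reachable : ∀ x → x ∈ σ st → Reach x
    open Invariant

    module Initialisation (σi : Subset n) (σi-reachable : ∀ x → x ∈ σi → Reach x) where
      open Init Ri σi

      rowBlock : Fin n → Subset n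
      rowBlock x = tabulate (λ y → ⌊ row y ≟ˢ row x ⌋)

      colBlock : Fin n → Subset n
      colBlock x = tabulate (λ y → ⌊ col y ≟ˢ col x ⌋)

      ∈rowBlock⁻ : ∀ {x w} → x ∈ rowBlock w → row x ≡ row w
      ∈rowBlock⁻ = toWitness ∘ x∈tabulate⁻

      ∈P₀⁻ : ∀ {A x} → A ∈ₗ P₀ → x ∈ A → ∃ λ w → A ≡ rowBlock w × row x ≡ row w
      ∈P₀⁻ A∈ x∈A with ∈-map⁻ rowBlock (∈-deduplicate⁻ _≟ˢ_ _ A∈)
      ... | w , _ , refl = w , refl , ∈rowBlock⁻ x∈A

      ∈rowB⁻ : ∀ {A y} → y ∈ rowB A → ∃ λ x → x ∈ A × T (Ri x y)
      ∈rowB⁻ y∈ with find (any⁻ _ (allFin n) (x∈tabulate⁻ y∈))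
      ... | x , _ , t = let x∈A , r = Equivalence.to T-∧ t in x , T[lookup]⇒∈ x∈A , r

      ∈rowB⁺ : ∀ {A x y} → x ∈ A → T (Ri x y) → y ∈ rowB A
      ∈rowB⁺ {x = x} x∈A r = x∈tabulate⁺ (any⁺ _ (lose (∈-allFin x) (Equivalence.from T-∧ (∈⇒T[lookup] x∈A , r))))

      Ri-row : ∀ {x x'} → row x ≡ row x' → ∀ {y} → T (Ri x' y) → T (Ri x y)
      Ri-row e {y} = subst T (sym (tabulate-injective e y))

      Ri-col : ∀ {y y'} → col y ≡ col y' → ∀ {x} → T (Ri x y') → T (Ri x y)
      Ri-col e {x} = subst T (sym (tabulate-injective e x))

      initial-invariant : Invariant initial
      initial-invariant .covers x =
        rowBlock x , ∈-deduplicate⁺ _≟ˢ_ (∈-map⁺ rowBlock (∈-allFin x)) , x∈tabulate⁺ (fromWitness refl)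
      initial-invariant .disjoint A∈ A'∈ x∈A x∈A' with ∈P₀⁻ A∈ x∈A | ∈P₀⁻ A'∈ x∈A'
      ... | w , refl , e | w' , refl , e' = cong (λ r → tabulate (λ y → ⌊ row y ≟ˢ r ⌋)) (trans (sym e) e')
      initial-invariant .Rsim⊆R {A} {x} {y} A∈ x∈A r =
        x∈⋃⁺ (∈-filter⁺ (T? ∘ λ C → ⌊ C ⊆? rowB A ⌋) colBlock∈Q₀ (fromWitness (λ {z} → colBlock⊆rowB {z})))
             (x∈tabulate⁺ (fromWitness refl))
        where
        colBlock∈Q₀ : colBlock y ∈ₗ Q₀
        colBlock∈Q₀ = ∈-deduplicate⁺ _≟ˢ_ (∈-map⁺ colBlock (∈-allFin y))
        colBlock⊆rowB : colBlock y ⊆ rowB A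
        colBlock⊆rowB z∈ = ∈rowB⁺ x∈A (Ri-col (toWitness (x∈tabulate⁻ z∈)) (Rsim⊆Ri r))
      initial-invariant .R⊆Ri {A} A∈ x∈A y∈ with x∈⋃⁻ (τ₀ A) y∈
      ... | C , C∈ , y∈C with ∈-filter⁻ (T? ∘ λ C → ⌊ C ⊆? rowB A ⌋) {xs = Q₀} C∈
      ... | _ , C⊆rowB with ∈rowB⁻ {A} (toWitness C⊆rowB y∈C)
      ... | x' , x'∈A , r with ∈P₀⁻ A∈ x∈A
      ... | w , refl , e = Ri-row (trans e (sym (∈rowBlock⁻ x'∈A))) r
      initial-invariant .σ-reachable = σi-reachable

    search-invariant : ∀ {st s} → Invariant st → s ∈ I ∪ post (σ st) → Invariant (search st s)
    search-invariant inv _ .covers      = inv .covers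
    search-invariant inv _ .disjoint    = inv .disjoint
    search-invariant inv _ .Rsim⊆R      = inv .Rsim⊆R
    search-invariant inv _ .R⊆Ri        = inv .R⊆Ri
    search-invariant {st} {s} inv s∈ .σ-reachable z z∈ with x∈p∪q⁻ (σ st) ⁅ s ⁆ z∈
    ... | inj₁ z∈σ = inv .σ-reachable z z∈σ
    ... | inj₂ z∈s with x∈⁅y⁆⇒x≡y s z∈s | x∈p∪q⁻ I (post (σ st)) s∈
    ... | refl | inj₁ s∈I    = init s∈I
    ... | refl | inj₂ s∈post = let w , w∈σ , a , w→s = y∈post⁻ s∈post in step a (inv .σ-reachable w w∈σ) w→s

    module Refinement (st : AState) (inv : Invariant st) (a : Fin m) (B C : Subset n)
                      (B∈P : B ∈ₗ P st) (C∈P : C ∈ₗ P st) where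

      -- These reproduce the local definitions of refine, so that refine st a B C
      -- is definitionally ⟨ P₁ , τ₃ , _ , σ st ⟩.
      S B' B'' : Subset n
      S   = pre a (Uτ st C)
      B'  = B ∩ pre a C
      B'' = B ∩ ∁ (pre a C)

      replaceB : Subset n → List (Subset n)
      replaceB A = if ⌊ A ≟ˢ B ⌋
                     then B' ∷ (if ⌊ nonempty? B'' ⌋ then B'' ∷ [] else [])
                     else A ∷ []

      P₁ : List (Subset n)
      P₁ = concatMap replaceB (P st)

      τ₁ : Subset n → List (Subset n)
      τ₁ A = if ⌊ A ≟ˢ B' ⌋ ∨ ⌊ A ≟ˢ B'' ⌋ then τ st B else τ st A

      splits : Subset n → Bool
      splits X = any (λ Z → ⌊ Z ≟ˢ X ⌋) (τ₁ B') ∧ ⌊ nonempty? (X ∩ S) ⌋ ∧ not ⌊ X ⊆? S ⌋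

      τ₂ : Subset n → List (Subset n)
      τ₂ A = concatMap (λ X → splitIf (splits X) X S) (τ₁ A)

      keepInS : List (Subset n) → List (Subset n)
      keepInS = filterᵇ (λ E → ⌊ E ⊆? S ⌋)

      τ₃ : Subset n → List (Subset n)
      τ₃ A = if ⌊ A ≟ˢ B' ⌋ then keepInS (τ₂ A) else τ₂ A

      Half : Subset n → Set
      Half A = A ≡ B' ⊎ A ≡ B''

      half-⊆ : ∀ {A} → Half A → A ⊆ B
      half-⊆ (inj₁ refl) = p∩q⊆p B (pre a C)
      half-⊆ (inj₂ refl) = p∩q⊆p B (∁ (pre a C))

      B'∩B''-empty : ∀ {x} → x ∈ B' → x ∈ B'' → ⊥
      B'∩B''-empty x∈B' x∈B'' = x∈p⇒x∉∁p (p∩q⊆q B _ x∈B') (p∩q⊆q B _ x∈B'')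

      ∈P₁⁻ : ∀ {A} → A ∈ₗ P₁ → Half A ⊎ (A ∈ₗ P st × A ≢ B)
      ∈P₁⁻ A∈ with find (∈-concatMap⁻ replaceB {P st} A∈)
      ... | A₀ , A₀∈P , A∈ = from-replaceB (A₀ ≟ˢ B) (nonempty? B'') A∈
        where
        from-replaceB : ∀ {A} (d : Dec (A₀ ≡ B)) (d' : Dec (Nonempty B'')) →
          A ∈ₗ (if ⌊ d ⌋ then B' ∷ (if ⌊ d' ⌋ then B'' ∷ [] else []) else A₀ ∷ []) →
          Half A ⊎ (A ∈ₗ P st × A ≢ B)
        from-replaceB (yes _) _       (here refl)         = inj₁ (inj₁ refl)
        from-replaceB (yes _) (yes _) (there (here refl)) = inj₁ (inj₂ refl)
        from-replaceB (no ≢B) _       (here refl)         = inj₂ (A₀∈P , ≢B)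

      B'∈P₁ : B' ∈ₗ P₁
      B'∈P₁ = ∈-concatMap⁺ replaceB (lose B∈P (subst (B' ∈ₗ_) (sym (if-yes (B ≟ˢ B) refl)) (here refl)))

      B''∈P₁ : Nonempty B'' → B'' ∈ₗ P₁
      B''∈P₁ ne = ∈-concatMap⁺ replaceB (lose B∈P (subst (B'' ∈ₗ_) (sym (if-yes (B ≟ˢ B) refl))
                    (there (subst (B'' ∈ₗ_) (sym (if-yes (nonempty? B'') ne)) (here refl)))))

      A∈P₁ : ∀ {A} → A ∈ₗ P st → A ≢ B → A ∈ₗ P₁
      A∈P₁ {A} A∈P A≢B = ∈-concatMap⁺ replaceB (lose A∈P (subst (A ∈ₗ_) (sym (if-no (A ≟ˢ B) A≢B)) (here refl)))

      τ₁-cases : ∀ A → (Half A × τ₁ A ≡ τ st B) ⊎ (¬ Half A × τ₁ A ≡ τ st A)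
      τ₁-cases A = cases (A ≟ˢ B') (A ≟ˢ B'')
        where
        cases : (d : Dec (A ≡ B')) (d' : Dec (A ≡ B'')) →
                let τ₁A = if ⌊ d ⌋ ∨ ⌊ d' ⌋ then τ st B else τ st A in
                (Half A × τ₁A ≡ τ st B) ⊎ (¬ Half A × τ₁A ≡ τ st A)
        cases (yes e) _        = inj₁ (inj₁ e , refl)
        cases (no _)  (yes e)  = inj₁ (inj₂ e , refl)
        cases (no ≢B') (no ≢B'') = inj₂ ([ ≢B' , ≢B'' ] , refl)

      τ₁-B' : τ₁ B' ≡ τ st B
      τ₁-B' with τ₁-cases B'
      ... | inj₁ (_ , e)   = e
      ... | inj₂ (¬h , _) = contradiction (inj₁ refl) ¬h

      τ₁-inherited : ∀ {A x} → A ∈ₗ P₁ → x ∈ A → ∃ λ A₀ → A₀ ∈ₗ P st × x ∈ A₀ × τ₁ A ≡ τ st A₀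
      τ₁-inherited {A} A∈ x∈A with τ₁-cases A | ∈P₁⁻ A∈
      ... | inj₁ (h , e)  | _                = B , B∈P , half-⊆ h x∈A , e
      ... | inj₂ (¬h , _) | inj₁ h           = contradiction h ¬h
      ... | inj₂ (_ , e)  | inj₂ (A∈P , _)   = A , A∈P , x∈A , e

      τ₃-B' : τ₃ B' ≡ keepInS (τ₂ B')
      τ₃-B' = if-yes (B' ≟ˢ B') refl

      τ₃-other : ∀ {A} → A ≢ B' → τ₃ A ≡ τ₂ A
      τ₃-other {A} = if-no (A ≟ˢ B')

      ⋃τ₃⊆⋃τ₁ : ∀ A → ⋃ (τ₃ A) ⊆ ⋃ (τ₁ A)
      ⋃τ₃⊆⋃τ₁ A = ⋃-splitIf⁻ splits S (τ₁ A) ∘ ⋃-mono τ₃⊆τ₂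
        where
        τ₃⊆τ₂ : ∀ {Y} → Y ∈ₗ τ₃ A → Y ∈ₗ τ₂ A
        τ₃⊆τ₂ {Y} = filtered-or-not (A ≟ˢ B')
          where
          filtered-or-not : (d : Dec (A ≡ B')) → Y ∈ₗ (if ⌊ d ⌋ then keepInS (τ₂ A) else τ₂ A) → Y ∈ₗ τ₂ A
          filtered-or-not (yes _) = proj₁ ∘ ∈-filter⁻ (T? ∘ λ E → ⌊ E ⊆? S ⌋) {xs = τ₂ A}
          filtered-or-not (no _)  = λ Y∈ → Y∈

      ⋃τ₁⊆⋃τ₃ : ∀ {A} → A ≢ B' → ⋃ (τ₁ A) ⊆ ⋃ (τ₃ A)
      ⋃τ₁⊆⋃τ₃ {A} ≢B' {y} = subst (λ Ys → y ∈ ⋃ Ys) (sym (τ₃-other ≢B')) ∘ ⋃-splitIf⁺ splits S (τ₁ A)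

      straddling-splits : ∀ {X y} → X ∈ₗ τ₁ B' → y ∈ X → y ∈ S → ¬ X ⊆ S → T (splits X)
      straddling-splits {X} {y} X∈ y∈X y∈S X⊈S =
        Equivalence.from T-∧ (any⁺ (λ Z → ⌊ Z ≟ˢ X ⌋) (lose X∈ (fromWitness refl)) ,
          Equivalence.from T-∧ (fromWitness {a? = nonempty? (X ∩ S)} (y , x∈p∩q⁺ (y∈X , y∈S)) ,
                                fromWitnessFalse {a? = X ⊆? S} X⊈S))

      ⋃τ₁B'∩S⊆⋃τ₃B' : ∀ {y} → y ∈ ⋃ (τ₁ B') → y ∈ S → y ∈ ⋃ (τ₃ B')
      ⋃τ₁B'∩S⊆⋃τ₃B' {y} y∈ y∈S with x∈⋃⁻ (τ₁ B') y∈
      ... | X , X∈ , y∈X with splitIf-covers-inside (splits X) X S y∈X y∈S (straddling-splits X∈ y∈X y∈S)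
      ... | Y , Y∈ , y∈Y , Y⊆S =
        subst (λ Ys → y ∈ ⋃ Ys) (sym τ₃-B')
          (x∈⋃⁺ (∈-filter⁺ (T? ∘ λ E → ⌊ E ⊆? S ⌋) (∈-concatMap⁺ _ (lose X∈ Y∈)) (fromWitness (λ {z} → Y⊆S {z}))) y∈Y)

      Rsim⊆⋃τ₃ : ∀ {A x y} → A ∈ₗ P₁ → x ∈ A → Rsim x y → y ∈ ⋃ (τ₃ A)
      Rsim⊆⋃τ₃ {A} {x} {y} A∈ x∈A r = by-cases (A ≟ˢ B')
        where
        by-cases : Dec (A ≡ B') → y ∈ ⋃ (τ₃ A)
        by-cases (no A≢B') =
          let A₀ , A₀∈P , x∈A₀ , e = τ₁-inherited A∈ x∈A
          in ⋃τ₁⊆⋃τ₃ A≢B' (subst (λ Ys → y ∈ ⋃ Ys) (sym e) (inv .Rsim⊆R A₀∈P x∈A₀ r))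
        by-cases (yes refl) =
          let x' , x→x' , x'∈C = x∈pre⁻ (p∩q⊆q B (pre a C) x∈A)
              y' , y→y' , r'   = Rsim-step r x→x'
          in ⋃τ₁B'∩S⊆⋃τ₃B' (subst (λ Ys → y ∈ ⋃ Ys) (sym τ₁-B') (inv .Rsim⊆R B∈P (half-⊆ (inj₁ refl) x∈A) r))
                            (x∈pre⁺ y→y' (inv .Rsim⊆R C∈P x'∈C r'))

      refine-invariant : Invariant (refine st a B C)
      refine-invariant .covers x with inv .covers x
      ... | A , A∈P , x∈A with A ≟ˢ B
      ... | no A≢B = A , A∈P₁ A∈P A≢B , x∈A
      ... | yes refl with x ∈? pre a C
      ... | yes x∈pre = B' , B'∈P₁ , x∈p∩q⁺ (x∈A , x∈pre)
      ... | no  x∉pre = B'' , B''∈P₁ (x , x∈B'') , x∈B''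
        where
        x∈B'' : x ∈ B''
        x∈B'' = x∈p∩q⁺ (x∈A , x∉p⇒x∈∁p x∉pre)
      refine-invariant .disjoint A∈ A'∈ x∈A x∈A' with ∈P₁⁻ A∈ | ∈P₁⁻ A'∈
      ... | inj₁ (inj₁ refl) | inj₁ (inj₁ refl) = refl
      ... | inj₁ (inj₂ refl) | inj₁ (inj₂ refl) = refl
      ... | inj₁ (inj₁ refl) | inj₁ (inj₂ refl) = ⊥-elim (B'∩B''-empty x∈A x∈A')
      ... | inj₁ (inj₂ refl) | inj₁ (inj₁ refl) = ⊥-elim (B'∩B''-empty x∈A' x∈A)
      ... | inj₁ h | inj₂ (A'∈P , A'≢B) = contradiction (inv .disjoint A'∈P B∈P x∈A' (half-⊆ h x∈A)) A'≢B
      ... | inj₂ (A∈P , A≢B) | inj₁ h = contradiction (inv .disjoint A∈P B∈P x∈A (half-⊆ h x∈A')) A≢B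
      ... | inj₂ (A∈P , _) | inj₂ (A'∈P , _) = inv .disjoint A∈P A'∈P x∈A x∈A'
      refine-invariant .Rsim⊆R = Rsim⊆⋃τ₃
      refine-invariant .R⊆Ri {A} {x} {y} A∈ x∈A y∈ =
        let A₀ , A₀∈P , x∈A₀ , e = τ₁-inherited A∈ x∈A
        in inv .R⊆Ri A₀∈P x∈A₀ (subst (λ Ys → y ∈ ⋃ Ys) e (⋃τ₃⊆⋃τ₁ A y∈))
      refine-invariant .σ-reachable = inv .σ-reachable

    step-invariant : ∀ {st st'} → Step st st' → Invariant st → Invariant st'
    step-invariant {st} (searchStep B s _ s∈) inv = search-invariant inv (p∩q⊆q (Uτ st B) _ s∈)
    step-invariant (refineStep a B C (B∈P , C∈P , _)) inv = Refinement.refine-invariant _ inv a B C B∈P C∈P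

    run-invariant : ∀ {st st'} → Star Step st st' → Invariant st → Invariant st'
    run-invariant ε            inv = inv
    run-invariant (s ◅ steps) inv = run-invariant steps (step-invariant s inv)

    module Output (st : AState) (inv : Invariant st) (terminal : Terminal st) where

      private
        R : Fin n → Fin n → Set
        R = R2PR st

      block : Fin n → Subset n
      block x = proj₁ (inv .covers x)

      block∈P : ∀ x → block x ∈ₗ P st
      block∈P x = proj₁ (proj₂ (inv .covers x))

      x∈block : ∀ x → x ∈ block x
      x∈block x = proj₂ (proj₂ (inv .covers x))

      R⇔∈Uτ-block : ∀ {x y} → R x y ⇔ y ∈ Uτ st (block x)
      R⇔∈Uτ-block {x} {y} = mk⇔ to (λ y∈ → block x , block∈P x , x∈block x , y∈)
        where
        to : R x y → y ∈ Uτ st (block x)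
        to (A , A∈P , x∈A , y∈) = subst (λ A → y ∈ Uτ st A) (inv .disjoint A∈P (block∈P x) x∈A (x∈block x)) y∈

      Rsim⇒R : ∀ {x y} → Rsim x y → R x y
      Rsim⇒R {x} r = Equivalence.from R⇔∈Uτ-block (inv .Rsim⊆R (block∈P x) (x∈block x) r)

      Active : Fin n → Set
      Active x = ∃ λ s → R x s × s ∈ σ st

      R-step : ∀ {x x' y a} → Active x → T (tr a x x') → R x y → ∃ λ y' → T (tr a y y') × R x' y'
      R-step {x} {x'} {y} {a} (s , Rxs , s∈σ) x→x' Rxy with Uτ st (block x) ⊆? pre a (Uτ st (block x'))
      ... | no ⊈ = contradiction
            (block∈P x , block∈P x' , (s , x∈p∩q⁺ (Equivalence.to R⇔∈Uτ-block Rxs , s∈σ)) ,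
             (x , x∈p∩q⁺ (x∈block x , x∈pre⁺ x→x' (x∈block x'))) , ⊈)
            (proj₂ terminal a (block x) (block x'))
      ... | yes ⊆ with x∈pre⁻ (⊆ (Equivalence.to R⇔∈Uτ-block Rxy))
      ... | y' , y→y' , y'∈ = y' , y→y' , Equivalence.from R⇔∈Uτ-block y'∈

      active-if-R-meets-frontier : ∀ {x s} → R x s → s ∈ I ∪ post (σ st) → Active x
      active-if-R-meets-frontier {x} {s} (A , A∈P , x∈A , s∈) s∈frontier with nonempty? (Uτ st A ∩ σ st)
      ... | yes (z , z∈) = z , (A , A∈P , x∈A , p∩q⊆p _ _ z∈) , p∩q⊆q _ _ z∈
      ... | no empty = contradiction (A∈P , empty , s , x∈p∩q⁺ (s∈ , s∈frontier)) (proj₁ terminal A)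

      active-step : ∀ {x x' a} → Active x → T (tr a x x') → Active x'
      active-step active@(s , Rxs , s∈σ) x→x' with R-step active x→x' Rxs
      ... | s' , s→s' , Rx's' = active-if-R-meets-frontier Rx's' (x∈p∪q⁺ (inj₂ (y∈post⁺ s∈σ s→s')))

      reachable⇒active : ∀ {x} → Reach x → Active x
      reachable⇒active (init x∈I)      = active-if-R-meets-frontier (Rsim⇒R (Rsim-refl _)) (x∈p∪q⁺ (inj₁ x∈I))
      reachable⇒active (step a r x→x') = active-step (reachable⇒active r) x→x'

      active-R⇒Rsim : ∀ {x y} → Active x → R x y → Rsim x y
      active-R⇒Rsim {x} {y} active Rxy = proj₂ greatest R↾Active (R↾Active⊆Ri , R↾Active-step) x y (active , Rxy)
        where
        R↾Active : Fin n → Fin n → Set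
        R↾Active s t = Active s × R s t
        R↾Active⊆Ri : ∀ s t → R↾Active s t → T (Ri s t)
        R↾Active⊆Ri s t (_ , A , A∈P , s∈A , t∈) = inv .R⊆Ri A∈P s∈A t∈
        R↾Active-step : ∀ s t a s' → R↾Active s t → T (tr a s s') → ∃ λ t' → T (tr a t t') × R↾Active s' t'
        R↾Active-step s t a s' (active , Rst) s→s' with R-step active s→s' Rst
        ... | t' , t→t' , Rs't' = t' , t→t' , active-step active s→s' , Rs't'

      Rsim≐R : ∀ {x} → Active x → Rsim x ≐ R x
      Rsim≐R active z = mk⇔ Rsim⇒R (active-R⇒Rsim active)

      active-below : ∀ {x y} → Rsim x y → Active y → Active x
      active-below r active@(s , Rys , s∈σ) = s , Rsim⇒R (Rsim-trans r (active-R⇒Rsim active Rys)) , s∈σ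

      Rsim-reachable⇒active : ∀ {x z} → Rsim x z → Reach z → Active x
      Rsim-reachable⇒active r = active-below r ∘ reachable⇒active

      images-eq : ImagesEq Rsim st
      images-eq = (λ x (z , r , z-reach) → let active = Rsim-reachable⇒active r z-reach in
                     x , active , Rsim≐R active) ,
                  (λ y (z , Ryz , z∈σ) → y , (z , active-R⇒Rsim (z , Ryz , z∈σ) Ryz , inv .σ-reachable z z∈σ) ,
                     Rsim≐R (z , Ryz , z∈σ))

      same-block⇒R≐ : ∀ {x w} → w ∈ block x → R w ≐ R x
      same-block⇒R≐ {x} {w} w∈ v = mk⇔ (move (sym same)) (move same)
        where
        same : block x ≡ block w
        same = inv .disjoint (block∈P x) (block∈P w) w∈ (x∈block w)
        move : ∀ {u u'} → block u ≡ block u' → R u v → R u' v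
        move e = Equivalence.from R⇔∈Uτ-block ∘ subst (λ A → v ∈ Uτ st A) e ∘ Equivalence.to R⇔∈Uτ-block

      simBlock≐block2PR : ∀ {x} → Active x → blockSim Rsim x ≐ block2PR st x
      simBlock≐block2PR {x} active y = mk⇔ to from
        where
        to : blockSim Rsim x y → block2PR st x y
        to (rxy , ryx) w = mk⇔ (λ Ryw → Rsim⇒R (Rsim-trans rxy (active-R⇒Rsim (active-below ryx active) Ryw)))
                               (λ Rxw → Rsim⇒R (Rsim-trans ryx (active-R⇒Rsim active Rxw)))
        from : block2PR st x y → blockSim Rsim x y
        from R≐ = active-R⇒Rsim active (Equivalence.to (R≐ y) (Rsim⇒R (Rsim-refl y))) ,
                  active-R⇒Rsim y-active (Equivalence.from (R≐ x) (Rsim⇒R (Rsim-refl x)))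
          where
          y-active : Active y
          y-active = let s , Rxs , s∈σ = active in s , Equivalence.from (R≐ s) Rxs , s∈σ

      blocks-incl : BlocksIncl Rsim st
      blocks-incl x (z , (rxz , _) , z-reach) with Rsim-reachable⇒active rxz z-reach
      ... | active@(s , Rxs , s∈σ) =
        x , simBlock≐block2PR active , block x , block∈P x , (λ _ → same-block⇒R≐) ,
        (s , x∈p∩q⁺ (Equivalence.to R⇔∈Uτ-block Rxs , s∈σ))

theorem5 : ∀ {n m : ℕ} (I : Subset n) (tr : Fin m → Fin n → Fin n → Bool)
           (Ri : Fin n → Fin n → Bool) (σi : Subset n) →
           TS.IsPreorderᵇ I tr Ri →
           (∀ x → x ∈ σi → TS.Reach I tr x) →
           (st : TS.AState I tr) → TS.IsOutput I tr Ri σi st →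
           (Rsim : Fin n → Fin n → Set) → TS.IsGreatestSimulation I tr Ri Rsim →
           TS.ImagesEq I tr Rsim st × TS.BlocksIncl I tr Rsim st
theorem5 I tr Ri σi preorder σi-reachable st (run , terminal) Rsim greatest = images-eq , blocks-incl
  where
  open Algorithm2.Correctness I tr Ri preorder Rsim greatest
  open Initialisation σi σi-reachable using (initial-invariant)
  open Output st (run-invariant run initial-invariant) terminal using (images-eq; blocks-incl)
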